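{- Let $\mathcal{P}$ be a well-formed integer program, let $\alpha\in\mathcal{P}$ be a simple recursion of degree $d$ such that $\mathrm{guard}(\alpha)\implies\mathrm{cost}(\alpha)\geq 1$ is valid, and let $\chi_\psi\cdot b$ be a metering function for $\alpha$. Let $\alpha'$ be the rule \[ \mathrm{lhs}(\alpha)\xrightarrow{c}\emptyset\ [\mathrm{guard}(\alpha)\land\psi]\quad\text{where } c=\frac{d^b-1}{d-1}, \] and let $\mathcal{P}'=\mathcal{P}\cup\{\alpha'\}$. Then $\mathcal{P}'$ is well formed and the processor mapping $\mathcal{P}$ to $\mathcal{P}'$ is sound.
   Context: Fix a finite set $\Sigma$ of function symbols of common arity $k$ containing a start symbol $f_0$, and variables ranging over $\mathbb{Z}$. Arithmetic expressions are built from variables, numbers and operations such as $+,-,\cdot$, division, exponentiation; a constraint is a finite conjunction of inequations between arithmetic expressions. A rule has the form $f(\vec x)\xrightarrow{c}T\ [\varphi]$ where $\vec x=(x_1,\dots,x_k)$ is a fixed vector of pairwise different program variables, $f\in\Sigma$, $c$ an arithmetic expression (cost), $T$ a finite multiset of terms $g(t_1,\dots,t_k)$ ($g\in\Sigma$, $t_i$ arithmetic expressions), $\varphi$ a constraint (guard); the degree of a rule is $|T|$. An integer program is a finite set of rules in which $f_0$ does not occur on right-hand sides. Substitutions map variables to arithmetic expressions, applied homomorphically; $\{\vec x/\vec t\}$ maps $x_i$ to $t_i$. An integer substitution maps variables of its domain to integers; $\sigma\models\varphi$ means all variables of $\varphi$ are in $\mathrm{dom}(\sigma)$ and $\sigma$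 models $\varphi$; $\sigma\models\alpha$ means all variables of $\alpha$ are in $\mathrm{dom}(\sigma)$ and $\sigma\models\mathrm{guard}(\alpha)$. A formula is valid if every integer substitution whose domain contains its variables models it. For a constraint $\psi$, $\chi_\psi\sigma=1$ if $\sigma\models\psi$ and $0$ otherwise. A configuration is a finite multiset of terms $f(n_1,\dots,n_k)$, $n_i\in\mathbb{Z}$. $S\xrightarrow{k}_{\mathcal{P}}T$ if there are $s\in S$, a rule $f(\vec x)\xrightarrow{c}Q\ [\varphi]$ in $\mathcal{P}$ and an integer substitution $\sigma$ covering the rule's variables with $f(\vec x)\sigma=s$, $\sigma\models\varphi$, $c\sigma=k$, $T=(S\setminus\{s\})\cup Q\sigma$; costs of sequences are summed. $\mathrm{dh}_{\mathcal{P}}(S)=\sup\{k\mid S\xrightarrow{k}{}^{*}_{\mathcal{P}}T\}$, $\mathrm{rc}_{\mathcal{P}}(n)=\sup\{\mathrm{dh}_{\mathcal{P}}(f_0(\vec n))\mid\vec n\in\mathbb{Z}^k,\sum_i|n_i|\leq n\}$. A rule $\alpha$ is well formed if $t_i\sigma\in\mathbb{Z}$ for all $f(t_1,\dots,t_k)\in\mathrm{rhs}(\alpha)$, all $i$ and all integer $\sigma\models\alpha$; a program is well formed if all its rules are. A processor is a partial function on integer programs; it is sound if $\mathrm{rc}_{\mathcal{P}}(n)\geq\mathrm{rc}_{\mathrm{proc}(\mathcal{P})}(n)$ for all $n\in\mathbb{N}$ and all $\mathcal{P}$ where it is defined. A simple recursion is a rule $f(\vec x)\xrightarrow{c}T\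 [\varphi]$ with $|T|>1$ in which every term of $T$ has root $f$. An expression $b$ is a metering function for such a rule $\alpha$ if $\neg\mathrm{guard}(\alpha)\implies b\leq0$ is valid and $\mathrm{guard}(\alpha)\implies b\{\vec x/\vec t\}\geq b-1$ is valid for all $f(\vec t)\in T$. -}

module Defs where

open import Data.Nat as ℕ using (ℕ; zero; suc)
open import Data.Integer as ℤ using (ℤ)
open import Data.Rational as ℚ using (ℚ; 0ℚ; 1ℚ)
import Data.Rational.Properties as ℚP
open import Data.Fin using (Fin; toℕ; fromℕ<)
open import Data.Vec as Vec using (Vec; []; _∷_; lookup)
open import Data.List as List using (List; []; _∷_; _++_; length)
open import Data.List.Membership.Propositional using (_∈_)
open import Data.List.Relation.Binary.Permutation.Propositional using (_↭_)
open import Data.Maybe using (Maybe; just; nothing; _>>=_)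
open import Data.Bool using (Bool; true; false; _∧_; T; if_then_else_)
open import Data.Product using (Σ; ∃; _×_; _,_; proj₁; proj₂)
open import Relation.Binary.PropositionalEquality using (_≡_; _≢_)
open import Relation.Nullary using (yes; no; does; ¬_)

infixl 6 _+ₑ_ _-ₑ_
infixl 7 _*ₑ_ _/ₑ_
infixr 8 _^ₑ_

data Expr : Set where
  var  : ℕ → Expr
  num  : ℤ → Expr
  _+ₑ_ _-ₑ_ _*ₑ_ _/ₑ_ _^ₑ_ : Expr → Expr → Expr

-- integer substitutions; total assignments (every variable is in the domain)
Assignment : Set
Assignment = ℕ → ℤ

ℤtoℚ : ℤ → ℚ
ℤtoℚ z = z ℚ./ 1

isInt : ℚ → Maybe ℤ
isInt q with ℚ.denominatorℕ q ℕ.≟ 1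
... | yes _ = just (ℚ.numerator q)
... | no _  = nothing

powℕ : ℚ → ℕ → ℚ
powℕ q zero    = 1ℚ
powℕ q (suc n) = q ℚ.* powℕ q n

divQ : ℚ → ℚ → Maybe ℚ
divQ p q with q ℚP.≟ 0ℚ
... | yes _   = nothing
... | no q≢0  = just (ℚ._÷_ p q {{ℚ.≢-nonZero q≢0}})

powQ : ℚ → ℚ → Maybe ℚ
powQ p q with isInt q
... | nothing          = nothing
... | just (ℤ.+ n)     = just (powℕ p n)
... | just (ℤ.-[1+ n ]) = divQ 1ℚ (powℕ p (suc n))

eval : Expr → Assignment → Maybe ℚ
eval (var x)  σ = just (ℤtoℚ (σ x))
eval (num z)  σ = just (ℤtoℚ z)
eval (a +ₑ b) σ = eval a σ >>= λ p → eval b σ >>= λ q → just (p ℚ.+ q)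
eval (a -ₑ b) σ = eval a σ >>= λ p → eval b σ >>= λ q → just (p ℚ.- q)
eval (a *ₑ b) σ = eval a σ >>= λ p → eval b σ >>= λ q → just (p ℚ.* q)
eval (a /ₑ b) σ = eval a σ >>= λ p → eval b σ >>= λ q → divQ p q
eval (a ^ₑ b) σ = eval a σ >>= λ p → eval b σ >>= λ q → powQ p q

evalℤ : Expr → Assignment → Maybe ℤ
evalℤ e σ = eval e σ >>= isInt

data Rel : Set where
  lt le eq ne ge gt : Rel

record Atom : Set where
  constructor atom
  field
    rel : Rel
    lhs : Expr
    rhs : Expr

Constraint : Set
Constraint = List Atom

relB : Rel → ℚ → ℚ → Bool
relB lt p q = does (p ℚP.<? q)
relB le p q = does (p ℚP.≤? q)
relB eq p q = does (p ℚP.≟ q)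
relB ne p q = Data.Bool.not (does (p ℚP.≟ q))
  where import Data.Bool
relB ge p q = does (q ℚP.≤? p)
relB gt p q = does (q ℚP.<? p)

atomB : Atom → Assignment → Bool
atomB (atom r l u) σ with eval l σ | eval u σ
... | just p | just q = relB r p q
... | _      | _      = false

satB : Constraint → Assignment → Bool
satB []       σ = true
satB (a ∷ as) σ = atomB a σ ∧ satB as σ

_⊨_ : Assignment → Constraint → Set
σ ⊨ φ = T (satB φ σ)

substE : (ℕ → Expr) → Expr → Expr
substE θ (var x)  = θ x
substE θ (num z)  = num z
substE θ (a +ₑ b) = substE θ a +ₑ substE θ b
substE θ (a -ₑ b) = substE θ a -ₑ substE θ b
substE θ (a *ₑ b) = substE θ a *ₑ substE θ b
substE θ (a /ₑ b) = substE θ a /ₑ substE θ b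
substE θ (a ^ₑ b) = substE θ a ^ₑ substE θ b

substA : (ℕ → Expr) → Atom → Atom
substA θ (atom r l u) = atom r (substE θ l) (substE θ u)

substC : (ℕ → Expr) → Constraint → Constraint
substC θ = List.map (substA θ)

-- {x⃗ / t⃗}: program variable x_i is the variable with index i (i < k)
progSubst : ∀ {k} → Vec Expr k → ℕ → Expr
progSubst {k} ts x with x ℕ.<? k
... | yes x<k = lookup ts (fromℕ< x<k)
... | no _    = var x

record Rule (k nΣ : ℕ) : Set where
  constructor rule
  field
    lhs   : Fin nΣ                      -- lhs is  lhs(x₀,…,x_{k-1})
    cost  : Expr
    rhs   : List (Fin nΣ × Vec Expr k)  -- finite multiset of terms
    guard : Constraint

open Rule public

Program : ℕ → ℕ → Set
Program k nΣ = List (Rule k nΣ)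

ConfTerm : ℕ → ℕ → Set
ConfTerm k nΣ = Fin nΣ × Vec ℤ k

-- configurations: finite multisets, represented as lists (up to ↭)
Config : ℕ → ℕ → Set
Config k nΣ = List (ConfTerm k nΣ)

module _ {k nΣ : ℕ} where

  evalVec : ∀ {m} → Vec Expr m → Assignment → Maybe (Vec ℤ m)
  evalVec []       σ = just []
  evalVec (t ∷ ts) σ = evalℤ t σ >>= λ z → evalVec ts σ >>= λ zs → just (z ∷ zs)

  instRhs : List (Fin nΣ × Vec Expr k) → Assignment → Maybe (Config k nΣ)
  instRhs []             σ = just []
  instRhs ((g , ts) ∷ Q) σ =
    evalVec ts σ >>= λ ns → instRhs Q σ >>= λ Q' → just ((g , ns) ∷ Q')

  record Step (P : Program k nΣ) (S : Config k nΣ) (c : ℚ) (T : Config k nΣ) : Set where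
    field
      L R    : Config k nΣ
      s      : ConfTerm k nΣ
      α      : Rule k nΣ
      σ      : Assignment
      Q      : Config k nΣ
      α∈P    : α ∈ P
      S≡     : S ≡ L ++ s ∷ R
      match₁ : lhs α ≡ proj₁ s
      match₂ : ∀ (i : Fin k) → σ (toℕ i) ≡ lookup (proj₂ s) i
      sat    : σ ⊨ guard α
      costEq : eval (cost α) σ ≡ just c
      rhsEq  : instRhs (rhs α) σ ≡ just Q
      T↭     : T ↭ (L ++ R) ++ Q

  data Reach (P : Program k nΣ) : Config k nΣ → ℚ → Config k nΣ → Set where
    done : ∀ {S} → Reach P S 0ℚ S
    more : ∀ {S U T c d} → Step P S c U → Reach P U d T → Reach P S (c ℚ.+ d) T

  norm : Vec ℤ k → ℕ
  norm ns = Vec.sum (Vec.map ℤ.∣_∣ ns)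

  -- rc_P(n) ≥ rc_P'(n), with rc the supremum in ℚ ∪ {±∞}:
  -- every value below some derivation cost in P' is exceeded by a derivation cost in P
  RcGe : Fin nΣ → Program k nΣ → Program k nΣ → ℕ → Set
  RcGe f0 P P' n =
    ∀ (ns : Vec ℤ k) → norm ns ℕ.≤ n →
    ∀ (c : ℚ) (T : Config k nΣ) → Reach P' ((f0 , ns) ∷ []) c T →
    ∀ (q : ℚ) → q ℚ.< c →
    Σ (Vec ℤ k) λ ms → norm ms ℕ.≤ n ×
      Σ ℚ λ c' → Σ (Config k nΣ) λ T' → Reach P ((f0 , ms) ∷ []) c' T' × q ℚ.< c'

  Sound : Fin nΣ → Program k nΣ → Program k nΣ → Set
  Sound f0 P P' = ∀ (n : ℕ) → RcGe f0 P P' n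

  IntegerProgram : Fin nΣ → Program k nΣ → Set
  IntegerProgram f0 P = ∀ α → α ∈ P → ∀ t → t ∈ rhs α → proj₁ t ≢ f0

  WellFormedRule : Rule k nΣ → Set
  WellFormedRule α = ∀ (σ : Assignment) → σ ⊨ guard α →
    ∀ t → t ∈ rhs α → ∀ (i : Fin k) → ∃ λ (z : ℤ) → eval (lookup (proj₂ t) i) σ ≡ just (ℤtoℚ z)

  WellFormed : Program k nΣ → Set
  WellFormed P = ∀ α → α ∈ P → WellFormedRule α

  degree : Rule k nΣ → ℕ
  degree α = length (rhs α)

  SimpleRecursion : Rule k nΣ → Set
  SimpleRecursion α = 1 ℕ.< degree α × (∀ t → t ∈ rhs α → proj₁ t ≡ lhs α)

  CostAtLeastOne : Rule k nΣ → Set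
  CostAtLeastOne α = ∀ (σ : Assignment) → σ ⊨ guard α → σ ⊨ (atom ge (cost α) (num (ℤ.+ 1)) ∷ [])

  meterVal : Constraint → Expr → Assignment → Maybe ℚ
  meterVal ψ b σ = if satB ψ σ then eval b σ else just 0ℚ

  MeteringFunction : Rule k nΣ → Constraint → Expr → Set
  MeteringFunction α ψ b =
    (∀ (σ : Assignment) → ¬ (σ ⊨ guard α) →
       ∃ λ v → meterVal ψ b σ ≡ just v × v ℚ.≤ 0ℚ)
    ×
    (∀ (σ : Assignment) → σ ⊨ guard α → ∀ t → t ∈ rhs α →
       ∃ λ v → ∃ λ v' → meterVal ψ b σ ≡ just v ×
         meterVal (substC (progSubst (proj₂ t)) ψ) (substE (progSubst (proj₂ t)) b) σ ≡ just v' ×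
         v ℚ.- 1ℚ ℚ.≤ v')

  accelerate : Rule k nΣ → Constraint → Expr → Rule k nΣ
  accelerate α ψ b = rule (lhs α)
    ((num (ℤ.+ degree α) ^ₑ b -ₑ num (ℤ.+ 1)) /ₑ (num (ℤ.+ degree α) -ₑ num (ℤ.+ 1)))
    []
    (guard α ++ ψ)

module Submission where

open import Defs
open import Data.Nat as ℕ using (ℕ; zero; suc)
import Data.Nat.Properties as ℕP
import Data.Nat.Coprimality as Coprime
open import Data.Integer as ℤ using (ℤ; +_; -[1+_])
import Data.Integer.Solver as ℤSolver
open import Data.Rational as ℚ using (ℚ; 0ℚ; 1ℚ; _+_; _*_; _-_; _≤_; _<_)
import Data.Rational.Properties as ℚP
import Data.Rational.Unnormalised as ℚᵘ
import Data.Rational.Unnormalised.Properties as ℚᵘP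
open import Data.Rational.Solver using (module +-*-Solver)
open import Data.Bool using (T; _∧_)
open import Data.Bool.Properties using (∧-assoc; T?; T-≡; T-∧)
open import Data.Fin as Fin using (Fin; toℕ; fromℕ<)
open import Data.Fin.Properties using (fromℕ<-toℕ; toℕ<n)
open import Data.Vec using (Vec; []; _∷_; lookup)
open import Data.List using (List; []; _∷_; _++_; [_]; length)
open import Data.List.Properties using (++-assoc; ++-identityʳ)
open import Data.List.Membership.Propositional using (_∈_)
open import Data.List.Membership.Propositional.Properties using (∈-insert; ∈-∃++)
open import Data.List.Relation.Unary.Any using (here; there)
open import Data.List.Relation.Binary.Permutation.Propositional
  using (_↭_; ↭-refl; ↭-sym; ↭-trans; ↭-reflexive; ↭-prep; module PermutationReasoning)
open import Data.List.Relation.Binary.Permutation.Propositional.Properties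
  using (∈-resp-↭; drop-mid; ++⁺ˡ; ++⁺ʳ; ++-comm; shift)
open import Data.Maybe using (just)
open import Data.Maybe.Properties using (just-injective)
open import Data.Product using (∃; ∃₂; _×_; _,_; proj₁; proj₂)
open import Data.Sum using (_⊎_; inj₁; inj₂)
open import Data.Empty using (⊥-elim)
open import Function using (Equivalence; _∘_)
open import Relation.Binary.PropositionalEquality
  using (_≡_; refl; sym; trans; cong; subst; module ≡-Reasoning)
open import Relation.Nullary using (yes; no)
open import Relation.Nullary.Decidable using (toWitness; isYes≗does)

-- Every derivation of P ∪ {α′} is simulated by a derivation of P of at least the same cost.
-- Steps with rules of P are kept. An α′-step at σ, where b evaluates to n ≥ 0, is replaced by
-- the complete d-ary tree of α-steps of depth n below the same term: the metering function
-- drops by at most one from a node to its children and is ≤ 0 wherever the guard fails, so the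
-- guard holds at every inner node, and each of the 1 + d + … + d^(n-1) = (d^n − 1)/(d − 1)
-- steps costs at least 1. For negative b the cost of α′ is ≤ 0 and the empty derivation
-- suffices. Well-formedness is immediate since α′ has no right-hand side.

ℤtoℚ-+ : ∀ i j → ℤtoℚ (i ℤ.+ j) ≡ ℤtoℚ i + ℤtoℚ j
ℤtoℚ-+ i j = ℚP.toℚᵘ-injective (begin
  ℚ.toℚᵘ (ℤtoℚ (i ℤ.+ j))               ≈⟨ ℚP.toℚᵘ-fromℚᵘ (ℚᵘ.mkℚᵘ (i ℤ.+ j) 0) ⟩
  ℚᵘ.mkℚᵘ (i ℤ.+ j) 0                    ≈⟨ ℚᵘ.*≡* (ℤ-solve 2 (λ x y → (x :+ y) :* ₁ := (x :* ₁ :+ y :* ₁) :* ₁) refl i j) ⟩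
  ℚᵘ.mkℚᵘ i 0 ℚᵘ.+ ℚᵘ.mkℚᵘ j 0           ≈⟨ ℚᵘP.+-cong (fromℚᵘ-mkℚᵘ i) (fromℚᵘ-mkℚᵘ j) ⟩
  ℚ.toℚᵘ (ℤtoℚ i) ℚᵘ.+ ℚ.toℚᵘ (ℤtoℚ j)   ≈⟨ ℚᵘP.≃-sym (ℚP.toℚᵘ-homo-+ (ℤtoℚ i) (ℤtoℚ j)) ⟩
  ℚ.toℚᵘ (ℤtoℚ i + ℤtoℚ j)               ∎)
  where
  open ℚᵘP.≃-Reasoning
  open ℤSolver.+-*-Solver renaming (solve to ℤ-solve)
  ₁ = con (+ 1)
  fromℚᵘ-mkℚᵘ : ∀ z → ℚᵘ.mkℚᵘ z 0 ℚᵘ.≃ ℚ.toℚᵘ (ℤtoℚ z)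
  fromℚᵘ-mkℚᵘ z = ℚᵘP.≃-sym (ℚP.toℚᵘ-fromℚᵘ (ℚᵘ.mkℚᵘ z 0))

ℤtoℚ-suc : ∀ n → ℤtoℚ (+ suc n) ≡ 1ℚ + ℤtoℚ (+ n)
ℤtoℚ-suc n = ℤtoℚ-+ (+ 1) (+ n)

ℤtoℚ-suc-1 : ∀ n → ℤtoℚ (+ suc n) - 1ℚ ≡ ℤtoℚ (+ n)
ℤtoℚ-suc-1 n rewrite ℤtoℚ-suc n = solve 1 (λ x → (con 1ℚ :+ x) :- con 1ℚ := x) refl (ℤtoℚ (+ n))
  where open +-*-Solver

ℤtoℚ-nonNeg : ∀ n → 0ℚ ≤ ℤtoℚ (+ n)
ℤtoℚ-nonNeg zero    = ℚP.≤-refl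
ℤtoℚ-nonNeg (suc n) rewrite ℤtoℚ-suc n = ℚP.+-mono-≤ (ℚP.nonNegative⁻¹ 1ℚ) (ℤtoℚ-nonNeg n)

1≤ℤtoℚ : ∀ {n} → 1 ℕ.≤ n → 1ℚ ≤ ℤtoℚ (+ n)
1≤ℤtoℚ {suc n} _ rewrite ℤtoℚ-suc n = ℚP.+-monoʳ-≤ 1ℚ (ℤtoℚ-nonNeg n)

ℤtoℚ-suc-pos : ∀ n → 0ℚ < ℤtoℚ (+ suc n)
ℤtoℚ-suc-pos n = ℚP.<-≤-trans (ℚP.positive⁻¹ 1ℚ) (1≤ℤtoℚ {suc n} (ℕ.s≤s ℕ.z≤n))

0<ℤtoℚ-1 : ∀ d → 1 ℕ.< d → 0ℚ < ℤtoℚ (+ d) - 1ℚ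
0<ℤtoℚ-1 (suc zero)    (ℕ.s≤s ())
0<ℤtoℚ-1 (suc (suc n)) _ rewrite ℤtoℚ-suc-1 (suc n) = ℤtoℚ-suc-pos n

isInt-ℤtoℚ : ∀ z → isInt (ℤtoℚ z) ≡ just z
isInt-ℤtoℚ z = cong isInt (ℚP.fromℚᵘ-toℚᵘ (ℚ.mkℚ z 0 (Coprime.sym (Coprime.1-coprimeTo _))))

isInt-sound : ∀ q z → isInt q ≡ just z → q ≡ ℤtoℚ z
isInt-sound q z e with ℚ.denominatorℕ q ℕ.≟ 1
isInt-sound q z refl | yes d≡1 = trans (sym (ℚP.↥p/↧p≡p q)) (ℚP./-cong {ℚ.numerator q} refl d≡1)

geom : ℚ → ℕ → ℚ
geom x zero    = 0ℚ
geom x (suc m) = 1ℚ + x * geom x m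

geom-closed : ∀ x m → geom x m * (x - 1ℚ) ≡ powℕ x m - 1ℚ
geom-closed x zero    = solve 1 (λ x → con 0ℚ :* (x :- con 1ℚ) := con 1ℚ :- con 1ℚ) refl x
  where open +-*-Solver
geom-closed x (suc m) = begin
  (1ℚ + x * g) * (x - 1ℚ)        ≡⟨ solve 2 (λ x g → (con 1ℚ :+ x :* g) :* (x :- con 1ℚ)
                                                   := (x :- con 1ℚ) :+ x :* (g :* (x :- con 1ℚ))) refl x g ⟩
  (x - 1ℚ) + x * (g * (x - 1ℚ))  ≡⟨ cong (λ y → (x - 1ℚ) + x * y) (geom-closed x m) ⟩
  (x - 1ℚ) + x * (xᵐ - 1ℚ)       ≡⟨ solve 2 (λ x p → (x :- con 1ℚ) :+ x :* (p :- con 1ℚ)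
                                                   := x :* p :- con 1ℚ) refl x xᵐ ⟩
  x * xᵐ - 1ℚ                    ∎
  where
  open ≡-Reasoning
  open +-*-Solver
  g  = geom x m
  xᵐ = powℕ x m

1≤powℕ : ∀ x n → 1ℚ ≤ x → 1ℚ ≤ powℕ x n
1≤powℕ x zero    1≤x = ℚP.≤-refl
1≤powℕ x (suc n) 1≤x = begin
  1ℚ            ≤⟨ 1≤x ⟩
  x             ≡⟨ ℚP.*-identityʳ x ⟨
  x * 1ℚ        ≤⟨ ℚP.*-monoˡ-≤-nonNeg x (1≤powℕ x n 1≤x) ⟩
  x * powℕ x n  ∎
  where
  open ℚP.≤-Reasoning
  instance _ = ℚ.nonNegative (ℚP.≤-trans (ℚP.nonNegative⁻¹ 1ℚ) 1≤x)

*≡1⇒≤1 : ∀ r x → 1ℚ ≤ x → r * x ≡ 1ℚ → r ≤ 1ℚ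
*≡1⇒≤1 r x 1≤x rx≡1 with ℚP.≤-total r 1ℚ
... | inj₁ r≤1 = r≤1
... | inj₂ 1≤r = begin
  r       ≡⟨ ℚP.*-identityʳ r ⟨
  r * 1ℚ  ≤⟨ ℚP.*-monoˡ-≤-nonNeg r 1≤x ⟩
  r * x   ≡⟨ rx≡1 ⟩
  1ℚ      ∎
  where
  open ℚP.≤-Reasoning
  instance _ = ℚ.nonNegative (ℚP.≤-trans (ℚP.nonNegative⁻¹ 1ℚ) 1≤r)

divQ-sound : ∀ p q c → divQ p q ≡ just c → c * q ≡ p
divQ-sound p q c e with q ℚP.≟ 0ℚ
divQ-sound p q c refl | no q≢0 = begin
  p * 1/q * q    ≡⟨ ℚP.*-assoc p 1/q q ⟩
  p * (1/q * q)  ≡⟨ cong (p *_) (ℚP.*-inverseˡ q) ⟩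
  p * 1ℚ         ≡⟨ ℚP.*-identityʳ p ⟩
  p              ∎
  where
  open ≡-Reasoning
  instance _ = ℚ.≢-nonZero q≢0
  1/q = ℚ.1/ q

powQ-sound : ∀ x v p → powQ x v ≡ just p →
             (∃ λ n → v ≡ ℤtoℚ (+ n) × p ≡ powℕ x n) ⊎ (∃ λ n → divQ 1ℚ (powℕ x (suc n)) ≡ just p)
powQ-sound x v p e with isInt v in isInt-v
... | just (+ n)     = inj₁ (n , isInt-sound v (+ n) isInt-v , sym (just-injective e))
... | just -[1+ n ] = inj₂ (n , e)

-- cost (accelerate α ψ b) is definitionally geomₑ (degree α) b.
geomₑ : ℕ → Expr → Expr
geomₑ d b = (num (+ d) ^ₑ b -ₑ num (+ 1)) /ₑ (num (+ d) -ₑ num (+ 1))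

module _ (d : ℕ) (1<d : 1 ℕ.< d) where
  private
    D = ℤtoℚ (+ d)
    instance D-1-pos = ℚ.positive (0<ℤtoℚ-1 d 1<d)

  -- For b < 0 the power d^b lies in (0, 1], which makes the value nonpositive.
  eval-geomₑ : ∀ b σ c → eval (geomₑ d b) σ ≡ just c →
               (∃ λ n → eval b σ ≡ just (ℤtoℚ (+ n)) × c ≤ geom D n) ⊎ c ≤ 0ℚ
  eval-geomₑ b σ c e with eval b σ
  ... | just v with powQ D v in powQ-v
  ...   | just p with powQ-sound D v p powQ-v
  ...     | inj₁ (n , refl , refl) = inj₁ (n , refl , ℚP.*-cancelʳ-≤-pos (D - 1ℚ) (ℚP.≤-reflexive (begin
    c * (D - 1ℚ)         ≡⟨ divQ-sound _ _ c e ⟩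
    powℕ D n - 1ℚ        ≡⟨ geom-closed D n ⟨
    geom D n * (D - 1ℚ)  ∎)))
    where open ≡-Reasoning
  ...     | inj₂ (n , 1/Dⁿ⁺¹≡p) = inj₂ (ℚP.*-cancelʳ-≤-pos (D - 1ℚ) (begin
    c * (D - 1ℚ)   ≡⟨ divQ-sound _ _ c e ⟩
    p - 1ℚ         ≤⟨ ℚP.+-monoˡ-≤ (ℚ.- 1ℚ) p≤1 ⟩
    1ℚ - 1ℚ        ≡⟨ ℚP.*-zeroˡ (D - 1ℚ) ⟨
    0ℚ * (D - 1ℚ)  ∎))
    where
    open ℚP.≤-Reasoning
    p≤1 : p ≤ 1ℚ
    p≤1 = *≡1⇒≤1 p (powℕ D (suc n)) (1≤powℕ D (suc n) (1≤ℤtoℚ (ℕP.<⇒≤ 1<d))) (divQ-sound _ _ p 1/Dⁿ⁺¹≡p)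

evalℤ-sound : ∀ t σ z → evalℤ t σ ≡ just z → eval t σ ≡ just (ℤtoℚ z)
evalℤ-sound t σ z e with eval t σ
... | just q = cong just (isInt-sound q z e)

satB-++ : ∀ φ ψ σ → satB (φ ++ ψ) σ ≡ satB φ σ ∧ satB ψ σ
satB-++ []      ψ σ = refl
satB-++ (a ∷ φ) ψ σ rewrite satB-++ φ ψ σ = sym (∧-assoc (atomB a σ) (satB φ σ) (satB ψ σ))

⊨-++ : ∀ {σ} φ ψ → σ ⊨ (φ ++ ψ) → σ ⊨ φ × σ ⊨ ψ
⊨-++ {σ} φ ψ sat rewrite satB-++ φ ψ σ = Equivalence.to T-∧ sat

⊨-ge : ∀ {σ} l z → σ ⊨ (atom ge l (num z) ∷ []) → ∃ λ c → eval l σ ≡ just c × ℤtoℚ z ≤ c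
⊨-ge {σ} l z sat with eval l σ
... | just c = c , refl , toWitness (subst T (sym (isYes≗does z≤?c)) (proj₁ (Equivalence.to T-∧ sat)))
  where z≤?c = ℤtoℚ z ℚP.≤? c

EvaluatesTo : (ℕ → Expr) → Assignment → Assignment → Set
EvaluatesTo θ σ σ′ = ∀ x → eval (θ x) σ ≡ just (ℤtoℚ (σ′ x))

module _ {θ σ σ′} (θσ≡σ′ : EvaluatesTo θ σ σ′) where

  eval-substE : ∀ e → eval (substE θ e) σ ≡ eval e σ′
  eval-substE (var x)  = θσ≡σ′ x
  eval-substE (num z)  = refl
  eval-substE (a +ₑ b) rewrite eval-substE a | eval-substE b = refl
  eval-substE (a -ₑ b) rewrite eval-substE a | eval-substE b = refl
  eval-substE (a *ₑ b) rewrite eval-substE a | eval-substE b = refl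
  eval-substE (a /ₑ b) rewrite eval-substE a | eval-substE b = refl
  eval-substE (a ^ₑ b) rewrite eval-substE a | eval-substE b = refl

  satB-substC : ∀ φ → satB (substC θ φ) σ ≡ satB φ σ′
  satB-substC []               = refl
  satB-substC (atom r l u ∷ φ) rewrite eval-substE l | eval-substE u | satB-substC φ = refl

  meterVal-subst : ∀ {k nΣ} ψ b → meterVal {k} {nΣ} (substC θ ψ) (substE θ b) σ ≡ meterVal {k} {nΣ} ψ b σ′
  meterVal-subst ψ b rewrite satB-substC ψ | eval-substE b = refl

module _ {k : ℕ} where

  _[x⃗≔_] : Assignment → Vec ℤ k → Assignment
  (σ [x⃗≔ ns ]) x with x ℕ.<? k
  ... | yes x<k = lookup ns (fromℕ< x<k)
  ... | no  _   = σ x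

  [x⃗≔]-lookup : ∀ σ ns (i : Fin k) → (σ [x⃗≔ ns ]) (toℕ i) ≡ lookup ns i
  [x⃗≔]-lookup σ ns i with toℕ i ℕ.<? k
  ... | yes i<k = cong (lookup ns) (fromℕ<-toℕ i i<k)
  ... | no  i≮k = ⊥-elim (i≮k (toℕ<n i))

module _ {k nΣ : ℕ} where

  evalVec-lookup : ∀ {m} (ts : Vec Expr m) σ ns → evalVec {k} {nΣ} ts σ ≡ just ns →
                   ∀ i → eval (lookup ts i) σ ≡ just (ℤtoℚ (lookup ns i))
  evalVec-lookup (t ∷ ts) σ ns e i with evalℤ t σ in evalℤ-t | evalVec {k} {nΣ} ts σ in evalVec-ts
  evalVec-lookup (t ∷ ts) σ (z ∷ zs) refl Fin.zero    | just z | just zs = evalℤ-sound t σ z evalℤ-t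
  evalVec-lookup (t ∷ ts) σ (z ∷ zs) refl (Fin.suc i) | just z | just zs = evalVec-lookup ts σ zs evalVec-ts i

  evalVec-complete : ∀ {m} (ts : Vec Expr m) σ → (∀ i → ∃ λ z → eval (lookup ts i) σ ≡ just (ℤtoℚ z)) →
                     ∃ λ ns → evalVec {k} {nΣ} ts σ ≡ just ns
  evalVec-complete []       σ _        = [] , refl
  evalVec-complete (t ∷ ts) σ integral with integral Fin.zero | evalVec-complete ts σ (integral ∘ Fin.suc)
  ... | z , eval-t | zs , evalVec-ts rewrite eval-t | isInt-ℤtoℚ z | evalVec-ts = z ∷ zs , refl

  progSubst-evaluatesTo : ∀ (ts : Vec Expr k) σ ns → evalVec {k} {nΣ} ts σ ≡ just ns →
                          EvaluatesTo (progSubst ts) σ (σ [x⃗≔ ns ])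
  progSubst-evaluatesTo ts σ ns e x with x ℕ.<? k
  ... | yes x<k = evalVec-lookup ts σ ns e (fromℕ< x<k)
  ... | no  _   = refl

module _ {k nΣ : ℕ} {P : Program k nΣ} where

  reach-trans : ∀ {S U T c d} → Reach P S c U → Reach P U d T → Reach P S (c + d) T
  reach-trans {S} {T = T} {d = d} done r = subst (λ e → Reach P S e T) (sym (ℚP.+-identityˡ d)) r
  reach-trans {S} {T = T} {d = d} (more {c = c₁} {d = c₂} st r₁) r₂ =
    subst (λ e → Reach P S e T) (sym (ℚP.+-assoc c₁ c₂ d)) (more st (reach-trans r₁ r₂))

  step-frame : ∀ {S c U S′} E → Step P S c U → S′ ↭ S ++ E →
               ∃ λ U′ → Step P S′ c U′ × U′ ↭ U ++ E
  step-frame {U = U} E st@record { L = L ; R = R ; s = s ; Q = Q ; S≡ = refl ; T↭ = U↭ } S′↭S++E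
    rewrite ++-assoc L (s ∷ R) E
    with L′ , R′ , refl ← ∈-∃++ (∈-resp-↭ (↭-sym S′↭S++E) (∈-insert L))
    = (L′ ++ R′) ++ Q , st′ , U′↭U++E
    where
    st′ : Step P (L′ ++ s ∷ R′) _ ((L′ ++ R′) ++ Q)
    st′ = record { Step st hiding (L; R; S≡; T↭) ; L = L′ ; R = R′ ; S≡ = refl ; T↭ = ↭-refl }
    open PermutationReasoning
    U′↭U++E : (L′ ++ R′) ++ Q ↭ U ++ E
    U′↭U++E = begin
      (L′ ++ R′) ++ Q       ↭⟨ ++⁺ʳ Q (drop-mid L′ L S′↭S++E) ⟩
      (L ++ (R ++ E)) ++ Q  ≡⟨ cong (_++ Q) (++-assoc L R E) ⟨
      ((L ++ R) ++ E) ++ Q  ≡⟨ ++-assoc (L ++ R) E Q ⟩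
      (L ++ R) ++ (E ++ Q)  ↭⟨ ++⁺ˡ (L ++ R) (++-comm E Q) ⟩
      (L ++ R) ++ (Q ++ E)  ≡⟨ ++-assoc (L ++ R) Q E ⟨
      ((L ++ R) ++ Q) ++ E  ↭⟨ ++⁺ʳ E (↭-sym U↭) ⟩
      U ++ E                ∎

  reach-frame : ∀ {S c T S′} E → Reach P S c T → S′ ↭ S ++ E →
                ∃ λ T′ → Reach P S′ c T′ × T′ ↭ T ++ E
  reach-frame E done        S′↭ = _ , done , S′↭
  reach-frame E (more st r) S′↭
    with U′ , st′ , U′↭ ← step-frame E st S′↭
    with T′ , r′ , T′↭ ← reach-frame E r U′↭
    = T′ , more st′ r′ , T′↭

step-⊆ : ∀ {k nΣ} {P P′ : Program k nΣ} {S c U} (st : Step P′ S c U) → Step.α st ∈ P → Step P S c U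
step-⊆ st α∈P = record { Step st hiding (α∈P) ; α∈P = α∈P }

module _ {k nΣ : ℕ} where

  ReachAtLeast : Program k nΣ → Config k nΣ → ℚ → Set
  ReachAtLeast P S q = ∃₂ λ c T → Reach P S c T × q ≤ c

  LhsInstance : Rule k nΣ → Assignment → ConfTerm k nΣ → Set
  LhsInstance α σ s = lhs α ≡ proj₁ s × (∀ i → σ (toℕ i) ≡ lookup (proj₂ s) i)

module _ {k nΣ : ℕ} {P : Program k nΣ} where

  reachAtLeast-zero : ∀ {S} → ReachAtLeast P S 0ℚ
  reachAtLeast-zero = 0ℚ , _ , done , ℚP.≤-refl

  reachAtLeast-mono : ∀ {S q q′} → q ≤ q′ → ReachAtLeast P S q′ → ReachAtLeast P S q
  reachAtLeast-mono q≤q′ (c , T , r , q′≤c) = c , T , r , ℚP.≤-trans q≤q′ q′≤c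

  reachAtLeast-step : ∀ {S c U q} → Step P S c U → ReachAtLeast P U q → ReachAtLeast P S (c + q)
  reachAtLeast-step {c = c} st (d , T , r , q≤d) = c + d , T , more st r , ℚP.+-monoʳ-≤ c q≤d

  reachAtLeast-++ : ∀ {S S₁ S₂ q₁ q₂} → S ↭ S₁ ++ S₂ →
                    ReachAtLeast P S₁ q₁ → ReachAtLeast P S₂ q₂ → ReachAtLeast P S (q₁ + q₂)
  reachAtLeast-++ {S₂ = S₂} S↭ (c₁ , T₁ , r₁ , q₁≤c₁) (c₂ , T₂ , r₂ , q₂≤c₂)
    with T₁′ , r₁′ , T₁′↭ ← reach-frame S₂ r₁ S↭
    with T₂′ , r₂′ , _ ← reach-frame T₁ r₂ (↭-trans T₁′↭ (++-comm T₁ S₂))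
    = c₁ + c₂ , T₂′ , reach-trans r₁′ r₂′ , ℚP.+-mono-≤ q₁≤c₁ q₂≤c₂

  instRhs-reachAtLeast : ∀ {σ q} (R : List (Fin nΣ × Vec Expr k)) →
    (∀ {g ts} → (g , ts) ∈ R → ∃ λ ns → evalVec {k} {nΣ} ts σ ≡ just ns × ReachAtLeast P [ (g , ns) ] q) →
    ∃ λ Q → instRhs R σ ≡ just Q × ReachAtLeast P Q (ℤtoℚ (+ length R) * q)
  instRhs-reachAtLeast {q = q} [] _ =
    [] , refl , reachAtLeast-mono (ℚP.≤-reflexive (ℚP.*-zeroˡ q)) reachAtLeast-zero
  instRhs-reachAtLeast {q = q} ((g , ts) ∷ R) each
    with ns , evalVec-ts , first ← each (here refl)
    with Q , instRhs-R , rest ← instRhs-reachAtLeast R (each ∘ there)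
    rewrite evalVec-ts | instRhs-R
    = (g , ns) ∷ Q , refl , reachAtLeast-mono (ℚP.≤-reflexive count) (reachAtLeast-++ ↭-refl first rest)
    where
    n = ℤtoℚ (+ length R)
    count : ℤtoℚ (+ suc (length R)) * q ≡ q + n * q
    count rewrite ℤtoℚ-suc (length R) = solve 2 (λ n q → (con 1ℚ :+ n) :* q := q :+ n :* q) refl n q
      where open +-*-Solver

  simulation⇒sound : ∀ {P′ : Program k nΣ} f0 →
                     (∀ {S c T} → Reach P′ S c T → ReachAtLeast P S c) → Sound f0 P P′
  simulation⇒sound f0 simulate n ns ∣ns∣≤n c T r q q<c with c′ , T′ , r′ , c≤c′ ← simulate r =
    ns , ∣ns∣≤n , c′ , T′ , r′ , ℚP.<-≤-trans q<c c≤c′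

module Unfolding {k nΣ : ℕ} {P : Program k nΣ} {α : Rule k nΣ} {ψ : Constraint} {b : Expr}
  (wf : WellFormed P) (α∈P : α ∈ P) (simple : SimpleRecursion α) (cost≥1 : CostAtLeastOne α)
  (metering : MeteringFunction α ψ b) where

  private
    D = ℤtoℚ (+ degree α)

  unfold : ∀ m σ s v → LhsInstance α σ s → meterVal {k} {nΣ} ψ b σ ≡ just v → ℤtoℚ (+ m) ≤ v →
           ReachAtLeast P [ s ] (geom D m)

  unfold-child : ∀ m σ v → σ ⊨ guard α → meterVal {k} {nΣ} ψ b σ ≡ just v → ℤtoℚ (+ suc m) ≤ v →
                 ∀ {g ts} → (g , ts) ∈ rhs α →
                 ∃ λ ns → evalVec {k} {nΣ} ts σ ≡ just ns × ReachAtLeast P [ (g , ns) ] (geom D m)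

  unfold zero    _ _ _ _ _ _ = reachAtLeast-zero
  unfold (suc m) σ s v inst meter-v m+1≤v with T? (satB (guard α) σ)
  ... | no ¬guard
    with v₀ , meter-v₀ , v₀≤0 ← proj₁ metering σ ¬guard
    rewrite just-injective (trans (sym meter-v) meter-v₀)
    = ⊥-elim (ℚP.<-irrefl refl (ℚP.<-≤-trans (ℤtoℚ-suc-pos m) (ℚP.≤-trans m+1≤v v₀≤0)))
  ... | yes guard
    with c₀ , cost-c₀ , 1≤c₀ ← ⊨-ge (cost α) (+ 1) (cost≥1 σ guard)
    with Q , instRhs-Q , children ← instRhs-reachAtLeast (rhs α) (unfold-child m σ v guard meter-v m+1≤v)
    = reachAtLeast-mono (ℚP.+-monoˡ-≤ (D * geom D m) 1≤c₀) (reachAtLeast-step step children)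
    where
    step : Step P [ s ] c₀ Q
    step = record { L = [] ; R = [] ; s = s ; α = α ; σ = σ ; Q = Q ; α∈P = α∈P ; S≡ = refl
                  ; match₁ = proj₁ inst ; match₂ = proj₂ inst ; sat = guard
                  ; costEq = cost-c₀ ; rhsEq = instRhs-Q ; T↭ = ↭-refl }

  unfold-child m σ v guard meter-v m+1≤v {g} {ts} t∈rhs
    with ns , evalVec-ts ← evalVec-complete {k} {nΣ} ts σ (wf α α∈P σ guard (g , ts) t∈rhs)
    with v₁ , v′ , meter-v₁ , meter-child-v′ , v₁-1≤v′ ← proj₂ metering σ guard (g , ts) t∈rhs
    = ns , evalVec-ts , unfold m σ′ (g , ns) v′ inst′ meter′-v′ m≤v′
    where
    σ′ = σ [x⃗≔ ns ]
    inst′ : LhsInstance α σ′ (g , ns)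
    inst′ = sym (proj₂ simple (g , ts) t∈rhs) , [x⃗≔]-lookup σ ns
    meter′-v′ : meterVal {k} {nΣ} ψ b σ′ ≡ just v′
    meter′-v′ = trans (sym (meterVal-subst (progSubst-evaluatesTo {k} {nΣ} ts σ ns evalVec-ts) {k} {nΣ} ψ b))
                      meter-child-v′
    m≤v′ : ℤtoℚ (+ m) ≤ v′
    m≤v′ = begin
      ℤtoℚ (+ m)           ≡⟨ ℤtoℚ-suc-1 m ⟨
      ℤtoℚ (+ suc m) - 1ℚ  ≤⟨ ℚP.+-monoˡ-≤ (ℚ.- 1ℚ) m+1≤v ⟩
      v - 1ℚ               ≡⟨ cong (_- 1ℚ) (just-injective (trans (sym meter-v) meter-v₁)) ⟩
      v₁ - 1ℚ              ≤⟨ v₁-1≤v′ ⟩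
      v′                   ∎
      where open ℚP.≤-Reasoning

  accelerate-reachAtLeast : ∀ σ s c → LhsInstance α σ s → σ ⊨ guard (accelerate α ψ b) →
                            eval (cost (accelerate α ψ b)) σ ≡ just c → ReachAtLeast P [ s ] c
  accelerate-reachAtLeast σ s c inst sat cost-c with eval-geomₑ (degree α) (proj₁ simple) b σ c cost-c
  ... | inj₂ c≤0                = reachAtLeast-mono c≤0 reachAtLeast-zero
  ... | inj₁ (n , b≡n , c≤geom) = reachAtLeast-mono c≤geom (unfold n σ s (ℤtoℚ (+ n)) inst meter-n ℚP.≤-refl)
    where
    meter-n : meterVal {k} {nΣ} ψ b σ ≡ just (ℤtoℚ (+ n))
    meter-n rewrite Equivalence.to T-≡ (proj₂ (⊨-++ (guard α) ψ sat)) = b≡n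

  simulate-step : ∀ {S c U d} → Step (accelerate α ψ b ∷ P) S c U → ReachAtLeast P U d →
                  ReachAtLeast P S (c + d)
  simulate-step record { L = L ; R = R ; s = s ; σ = σ ; α∈P = here refl ; S≡ = refl ; match₁ = m₁
                       ; match₂ = m₂ ; sat = sat ; costEq = cost-c ; rhsEq = refl ; T↭ = U↭ } rest =
    reachAtLeast-++ S↭ (accelerate-reachAtLeast σ s _ (m₁ , m₂) sat cost-c) rest
    where
    S↭ : L ++ s ∷ R ↭ [ s ] ++ _
    S↭ = ↭-trans (shift s L R) (↭-prep s (↭-sym (↭-trans U↭ (↭-reflexive (++-identityʳ (L ++ R))))))
  simulate-step st@record { α∈P = there β∈P } rest = reachAtLeast-step (step-⊆ st β∈P) rest

  simulate : ∀ {S c T} → Reach (accelerate α ψ b ∷ P) S c T → ReachAtLeast P S c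
  simulate done        = reachAtLeast-zero
  simulate (more st r) = simulate-step st (simulate r)

module _ {k nΣ : ℕ} where

  wellFormed-∷ : ∀ {β : Rule k nΣ} {P} → WellFormedRule β → WellFormed P → WellFormed (β ∷ P)
  wellFormed-∷ wf-β _    _ (here refl)  = wf-β
  wellFormed-∷ _    wf-P γ (there γ∈P) = wf-P γ γ∈P

  accelerate-wellFormed : ∀ (α : Rule k nΣ) ψ b → WellFormedRule (accelerate α ψ b)
  accelerate-wellFormed _ _ _ _ _ _ ()

theorem4p5 : ∀ {k nΣ : ℕ} (f0 : Fin nΣ) (P : Program k nΣ) (α : Rule k nΣ)
             (ψ : Constraint) (b : Expr) →
             IntegerProgram f0 P → WellFormed P → α ∈ P →
             SimpleRecursion α → CostAtLeastOne α → MeteringFunction α ψ b →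
             WellFormed (accelerate α ψ b ∷ P) × Sound f0 P (accelerate α ψ b ∷ P)
theorem4p5 f0 P α ψ b _ wf α∈P simple cost≥1 metering =
  wellFormed-∷ (accelerate-wellFormed α ψ b) wf , simulation⇒sound f0 simulate
  where open Unfolding {ψ = ψ} {b} wf α∈P simple cost≥1 metering
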